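{- Let $p\ge 5$ be an odd prime, $x$ a generator of $\mathbb{Z}_p^*$, $y=x^{ -1}$, and $\mathcal{I}=\mathbb{Z}_p\times\mathbb{Z}_p$. For $(a,b)\in\mathcal{I}$ let $\pi_{(a,b)}$ be the permutation of $\mathcal{I}$ given by \[ \pi_{(a,b)}((c,d)) = \begin{cases} (a, a+b+d) & \text{if } c=0 \text{ and } a+b+d\ne 0,\\ (a+xb, 0) & \text{if } c=0 \text{ and } a+b+d=0,\\ (a+c+xb, 0) & \text{if } c\ne 0 \text{ and } b+d=0,\\ (a+c, b+d) & \text{if } c\ne 0 \text{ and } b+d\ne 0,\end{cases} \] let $\pi((c,d))=(yc,xd)$, and let $\sigma((c,d)) = (yc, yd)$. Then for every $(a,b)\in\mathcal{I}$, \[ \pi^{ -1}\circ \pi_{(xa,xb)} = \sigma^{ -1}\circ(\pi^{ -1}\circ\pi_{(a,b)})\circ\sigma. \]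
   Context: All arithmetic is in $\mathbb{Z}_p$. -}

module Defs where

open import Data.Nat using (ℕ; zero; suc; NonZero)
import Data.Nat as ℕ
open import Data.Nat.DivMod using (_mod_)
open import Data.Fin using (Fin; toℕ)
open import Data.Product using (_×_; _,_; ∃)
open import Relation.Binary.PropositionalEquality using (_≡_; _≢_)
open import Relation.Nullary using (Dec; yes; no)
import Data.Fin.Properties as FinP

Zp : (p : ℕ) → Set
Zp p = Fin p

module Arith (p : ℕ) .{{_ : NonZero p}} where
  infixl 6 _+ₚ_
  infixl 7 _*ₚ_

  zeroₚ : Zp p
  zeroₚ = 0 mod p

  oneₚ : Zp p
  oneₚ = 1 mod p

  _+ₚ_ : Zp p → Zp p → Zp p
  a +ₚ b = (toℕ a ℕ.+ toℕ b) mod p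

  _*ₚ_ : Zp p → Zp p → Zp p
  a *ₚ b = (toℕ a ℕ.* toℕ b) mod p

  _^ₚ_ : Zp p → ℕ → Zp p
  a ^ₚ zero = oneₚ
  a ^ₚ suc k = a *ₚ (a ^ₚ k)

  IsGenerator : Zp p → Set
  IsGenerator x = x ≢ zeroₚ × (∀ (z : Zp p) → z ≢ zeroₚ → ∃ λ k → x ^ₚ k ≡ z)

  𝓘 : Set
  𝓘 = Zp p × Zp p

  πab : (x : Zp p) → 𝓘 → 𝓘 → 𝓘
  πab x (a , b) (c , d) with c FinP.≟ zeroₚ | b +ₚ d FinP.≟ zeroₚ | a +ₚ b +ₚ d FinP.≟ zeroₚ
  ... | yes _ | _     | no _  = (a , a +ₚ b +ₚ d)
  ... | yes _ | _     | yes _ = (a +ₚ x *ₚ b , zeroₚ)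
  ... | no _  | yes _ | _     = (a +ₚ c +ₚ x *ₚ b , zeroₚ)
  ... | no _  | no _  | _     = (a +ₚ c , b +ₚ d)

  πmap : (x y : Zp p) → 𝓘 → 𝓘
  πmap x y (c , d) = (y *ₚ c , x *ₚ d)

  σmap : (y : Zp p) → 𝓘 → 𝓘
  σmap y (c , d) = (y *ₚ c , y *ₚ d)

-- Multiplication by a unit s is an automorphism of (ℤ_p, +) which fixes 0 and commutes with
-- multiplication by x, so it maps every test "… = 0" in the definition of π_(a,b) to the
-- corresponding test for π_(sa,sb); hence π_(sa,sb) ∘ σ_s = σ_s ∘ π_(a,b), where σ_s = σmap s
-- scales both coordinates by s.  With s = x we have σ_x = σ⁻¹, and σ_x commutes with the
-- diagonal map π, hence with π⁻¹.
module Submission where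

open import Defs
open import Data.Nat using (ℕ; NonZero; _≤_)
import Data.Nat as ℕ
import Data.Nat.Properties as ℕP
open import Data.Nat.DivMod using (_mod_; %-distribˡ-+; %-distribˡ-*; m<n⇒m%n≡m)
open import Data.Nat.Primality using (Prime)
open import Data.Fin using (toℕ)
import Data.Fin.Properties as FinP
open import Data.Product using (_,_)
open import Data.Empty using (⊥-elim)
open import Function using (_∘_)
open import Relation.Nullary using (yes; no)
open import Relation.Binary.PropositionalEquality
open ≡-Reasoning

module _ {A : Set} where

  left-inverse≗right-inverse : (f g h : A → A) →
    (∀ z → h (f z) ≡ z) → (∀ z → f (g z) ≡ z) → ∀ z → h z ≡ g z
  left-inverse≗right-inverse f g h hf fg z = trans (cong h (sym (fg z))) (hf (g z))

  inverse-commute : (f f⁻¹ g : A → A) →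
    (∀ z → f⁻¹ (f z) ≡ z) → (∀ z → f (f⁻¹ z) ≡ z) →
    (∀ z → f (g z) ≡ g (f z)) → ∀ z → f⁻¹ (g z) ≡ g (f⁻¹ z)
  inverse-commute f f⁻¹ g f⁻¹f ff⁻¹ fg z = begin
    f⁻¹ (g z)           ≡⟨ cong (f⁻¹ ∘ g) (sym (ff⁻¹ z)) ⟩
    f⁻¹ (g (f (f⁻¹ z))) ≡⟨ cong f⁻¹ (sym (fg (f⁻¹ z))) ⟩
    f⁻¹ (f (g (f⁻¹ z))) ≡⟨ f⁻¹f (g (f⁻¹ z)) ⟩
    g (f⁻¹ z)           ∎

module ZpProperties (p : ℕ) .{{_ : NonZero p}} where
  open Arith p

  toℕ-mod : ∀ m → toℕ (m mod p) ≡ m ℕ.% p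
  toℕ-mod m = FinP.toℕ-fromℕ< _

  toℕ-mod-id : (a : Zp p) → toℕ a mod p ≡ a
  toℕ-mod-id a = FinP.toℕ-injective (trans (toℕ-mod (toℕ a)) (m<n⇒m%n≡m (FinP.toℕ<n a)))

  mod-distrib-+ : ∀ m n → (m ℕ.+ n) mod p ≡ m mod p +ₚ n mod p
  mod-distrib-+ m n = FinP.toℕ-injective (begin
    toℕ ((m ℕ.+ n) mod p)                     ≡⟨ toℕ-mod (m ℕ.+ n) ⟩
    (m ℕ.+ n) ℕ.% p                           ≡⟨ %-distribˡ-+ m n p ⟩
    (m ℕ.% p ℕ.+ n ℕ.% p) ℕ.% p               ≡⟨ cong₂ (λ i j → (i ℕ.+ j) ℕ.% p) (toℕ-mod m) (toℕ-mod n) ⟨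
    (toℕ (m mod p) ℕ.+ toℕ (n mod p)) ℕ.% p   ≡⟨ toℕ-mod _ ⟨
    toℕ (m mod p +ₚ n mod p)                  ∎)

  mod-distrib-* : ∀ m n → (m ℕ.* n) mod p ≡ (m mod p) *ₚ (n mod p)
  mod-distrib-* m n = FinP.toℕ-injective (begin
    toℕ ((m ℕ.* n) mod p)                     ≡⟨ toℕ-mod (m ℕ.* n) ⟩
    (m ℕ.* n) ℕ.% p                           ≡⟨ %-distribˡ-* m n p ⟩
    ((m ℕ.% p) ℕ.* (n ℕ.% p)) ℕ.% p           ≡⟨ cong₂ (λ i j → (i ℕ.* j) ℕ.% p) (toℕ-mod m) (toℕ-mod n) ⟨
    (toℕ (m mod p) ℕ.* toℕ (n mod p)) ℕ.% p   ≡⟨ toℕ-mod _ ⟨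
    toℕ ((m mod p) *ₚ (n mod p))              ∎)

  *ₚ-comm : (a b : Zp p) → a *ₚ b ≡ b *ₚ a
  *ₚ-comm a b = cong (_mod p) (ℕP.*-comm (toℕ a) (toℕ b))

  *ₚ-assoc : (a b c : Zp p) → (a *ₚ b) *ₚ c ≡ a *ₚ (b *ₚ c)
  *ₚ-assoc a b c = begin
    (a *ₚ b) *ₚ c                               ≡⟨ cong ((toℕ a ℕ.* toℕ b) mod p *ₚ_) (toℕ-mod-id c) ⟨
    (toℕ a ℕ.* toℕ b) mod p *ₚ (toℕ c mod p)    ≡⟨ mod-distrib-* (toℕ a ℕ.* toℕ b) (toℕ c) ⟨
    (toℕ a ℕ.* toℕ b ℕ.* toℕ c) mod p           ≡⟨ cong (_mod p) (ℕP.*-assoc (toℕ a) (toℕ b) (toℕ c)) ⟩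
    (toℕ a ℕ.* (toℕ b ℕ.* toℕ c)) mod p         ≡⟨ mod-distrib-* (toℕ a) (toℕ b ℕ.* toℕ c) ⟩
    (toℕ a mod p) *ₚ ((toℕ b ℕ.* toℕ c) mod p)  ≡⟨ cong (_*ₚ (b *ₚ c)) (toℕ-mod-id a) ⟩
    a *ₚ (b *ₚ c)                               ∎

  x*ₚ[y*ₚz]≡y*ₚ[x*ₚz] : (a b c : Zp p) → a *ₚ (b *ₚ c) ≡ b *ₚ (a *ₚ c)
  x*ₚ[y*ₚz]≡y*ₚ[x*ₚz] a b c = begin
    a *ₚ (b *ₚ c)  ≡⟨ *ₚ-assoc a b c ⟨
    (a *ₚ b) *ₚ c  ≡⟨ cong (_*ₚ c) (*ₚ-comm a b) ⟩
    (b *ₚ a) *ₚ c  ≡⟨ *ₚ-assoc b a c ⟩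
    b *ₚ (a *ₚ c)  ∎

  *ₚ-distribˡ-+ₚ : (a b c : Zp p) → a *ₚ (b +ₚ c) ≡ a *ₚ b +ₚ a *ₚ c
  *ₚ-distribˡ-+ₚ a b c = begin
    a *ₚ (b +ₚ c)                                    ≡⟨ cong (_*ₚ (b +ₚ c)) (toℕ-mod-id a) ⟨
    (toℕ a mod p) *ₚ ((toℕ b ℕ.+ toℕ c) mod p)       ≡⟨ mod-distrib-* (toℕ a) (toℕ b ℕ.+ toℕ c) ⟨
    (toℕ a ℕ.* (toℕ b ℕ.+ toℕ c)) mod p              ≡⟨ cong (_mod p) (ℕP.*-distribˡ-+ (toℕ a) (toℕ b) (toℕ c)) ⟩
    (toℕ a ℕ.* toℕ b ℕ.+ toℕ a ℕ.* toℕ c) mod p      ≡⟨ mod-distrib-+ (toℕ a ℕ.* toℕ b) (toℕ a ℕ.* toℕ c) ⟩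
    a *ₚ b +ₚ a *ₚ c                                 ∎

  *ₚ-identityˡ : (a : Zp p) → oneₚ *ₚ a ≡ a
  *ₚ-identityˡ a = begin
    oneₚ *ₚ a                   ≡⟨ cong (oneₚ *ₚ_) (toℕ-mod-id a) ⟨
    (1 mod p) *ₚ (toℕ a mod p)  ≡⟨ mod-distrib-* 1 (toℕ a) ⟨
    (1 ℕ.* toℕ a) mod p         ≡⟨ cong (_mod p) (ℕP.*-identityˡ (toℕ a)) ⟩
    toℕ a mod p                 ≡⟨ toℕ-mod-id a ⟩
    a                           ∎

  *ₚ-zeroʳ : (a : Zp p) → a *ₚ zeroₚ ≡ zeroₚ
  *ₚ-zeroʳ a = begin
    a *ₚ zeroₚ                  ≡⟨ cong (_*ₚ zeroₚ) (toℕ-mod-id a) ⟨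
    (toℕ a mod p) *ₚ (0 mod p)  ≡⟨ mod-distrib-* (toℕ a) 0 ⟨
    (toℕ a ℕ.* 0) mod p         ≡⟨ cong (_mod p) (ℕP.*-zeroʳ (toℕ a)) ⟩
    zeroₚ                       ∎

  πmap-σmap : (x y s : Zp p) (w : 𝓘) → πmap x y (σmap s w) ≡ σmap s (πmap x y w)
  πmap-σmap x y s (c , d) = cong₂ _,_ (x*ₚ[y*ₚz]≡y*ₚ[x*ₚz] y s c) (x*ₚ[y*ₚz]≡y*ₚ[x*ₚz] x s d)

module UnitScaling (p : ℕ) .{{_ : NonZero p}} (s s⁻¹ : Zp p)
                   (s⁻¹s≡1 : Arith._*ₚ_ p s⁻¹ s ≡ Arith.oneₚ p) where
  open Arith p
  open ZpProperties p

  s⁻¹*ₚ[s*ₚa]≡a : (a : Zp p) → s⁻¹ *ₚ (s *ₚ a) ≡ a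
  s⁻¹*ₚ[s*ₚa]≡a a = begin
    s⁻¹ *ₚ (s *ₚ a)  ≡⟨ *ₚ-assoc s⁻¹ s a ⟨
    (s⁻¹ *ₚ s) *ₚ a  ≡⟨ cong (_*ₚ a) s⁻¹s≡1 ⟩
    oneₚ *ₚ a        ≡⟨ *ₚ-identityˡ a ⟩
    a                ∎

  σ⁻¹∘σ≗id : ∀ w → σmap s⁻¹ (σmap s w) ≡ w
  σ⁻¹∘σ≗id (c , d) = cong₂ _,_ (s⁻¹*ₚ[s*ₚa]≡a c) (s⁻¹*ₚ[s*ₚa]≡a d)

  s*ₚa≡0⇒a≡0 : ∀ {a} → s *ₚ a ≡ zeroₚ → a ≡ zeroₚ
  s*ₚa≡0⇒a≡0 {a} sa≡0 = begin
    a                ≡⟨ s⁻¹*ₚ[s*ₚa]≡a a ⟨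
    s⁻¹ *ₚ (s *ₚ a)  ≡⟨ cong (s⁻¹ *ₚ_) sa≡0 ⟩
    s⁻¹ *ₚ zeroₚ     ≡⟨ *ₚ-zeroʳ s⁻¹ ⟩
    zeroₚ            ∎

  preserves-zero : ∀ {a b} → s *ₚ a ≡ b → a ≡ zeroₚ → b ≡ zeroₚ
  preserves-zero sa≡b a≡0 = trans (sym sa≡b) (trans (cong (s *ₚ_) a≡0) (*ₚ-zeroʳ s))

  reflects-zero : ∀ {a b} → s *ₚ a ≡ b → b ≡ zeroₚ → a ≡ zeroₚ
  reflects-zero sa≡b b≡0 = s*ₚa≡0⇒a≡0 (trans sa≡b b≡0)

  *ₚ-distribˡ-+ₚ₃ : (a b c : Zp p) → s *ₚ (a +ₚ b +ₚ c) ≡ s *ₚ a +ₚ s *ₚ b +ₚ s *ₚ c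
  *ₚ-distribˡ-+ₚ₃ a b c =
    trans (*ₚ-distribˡ-+ₚ s (a +ₚ b) c) (cong (_+ₚ s *ₚ c) (*ₚ-distribˡ-+ₚ s a b))

  s*ₚ[a+ₚx*ₚb] : (x a b : Zp p) → s *ₚ (a +ₚ x *ₚ b) ≡ s *ₚ a +ₚ x *ₚ (s *ₚ b)
  s*ₚ[a+ₚx*ₚb] x a b =
    trans (*ₚ-distribˡ-+ₚ s a (x *ₚ b)) (cong (s *ₚ a +ₚ_) (x*ₚ[y*ₚz]≡y*ₚ[x*ₚz] s x b))

  πab-σmap : (x a b : Zp p) (w : 𝓘) →
    πab x (s *ₚ a , s *ₚ b) (σmap s w) ≡ σmap s (πab x (a , b) w)
  πab-σmap x a b (c , d)
    with c FinP.≟ zeroₚ | b +ₚ d FinP.≟ zeroₚ | a +ₚ b +ₚ d FinP.≟ zeroₚ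
       | s *ₚ c FinP.≟ zeroₚ | s *ₚ b +ₚ s *ₚ d FinP.≟ zeroₚ
       | s *ₚ a +ₚ s *ₚ b +ₚ s *ₚ d FinP.≟ zeroₚ
  ... | yes _ | _ | no _  | yes _ | _ | no _  = cong (s *ₚ a ,_) (sym (*ₚ-distribˡ-+ₚ₃ a b d))
  ... | yes _ | _ | yes _ | yes _ | _ | yes _ =
    cong₂ _,_ (sym (s*ₚ[a+ₚx*ₚb] x a b)) (sym (*ₚ-zeroʳ s))
  ... | no _ | yes _ | _ | no _ | yes _ | _ =
    cong₂ _,_ (sym (trans (s*ₚ[a+ₚx*ₚb] x (a +ₚ c) b)
                          (cong (_+ₚ x *ₚ (s *ₚ b)) (*ₚ-distribˡ-+ₚ s a c))))
              (sym (*ₚ-zeroʳ s))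
  ... | no _ | no _ | _ | no _ | no _ | _ =
    cong₂ _,_ (sym (*ₚ-distribˡ-+ₚ s a c)) (sym (*ₚ-distribˡ-+ₚ s b d))
  -- In the remaining combinations the two sides would take different branches.
  ... | yes ≡0 | _ | _ | no ≢0 | _ | _ = ⊥-elim (≢0 (preserves-zero refl ≡0))
  ... | no ≢0 | _ | _ | yes ≡0 | _ | _ = ⊥-elim (≢0 (reflects-zero refl ≡0))
  ... | yes _ | _ | no ≢0  | yes _ | _ | yes ≡0 = ⊥-elim (≢0 (reflects-zero (*ₚ-distribˡ-+ₚ₃ a b d) ≡0))
  ... | yes _ | _ | yes ≡0 | yes _ | _ | no ≢0  = ⊥-elim (≢0 (preserves-zero (*ₚ-distribˡ-+ₚ₃ a b d) ≡0))
  ... | no _ | yes ≡0 | _ | no _ | no ≢0  | _ = ⊥-elim (≢0 (preserves-zero (*ₚ-distribˡ-+ₚ s b d) ≡0))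
  ... | no _ | no ≢0  | _ | no _ | yes ≡0 | _ = ⊥-elim (≢0 (reflects-zero (*ₚ-distribˡ-+ₚ s b d) ≡0))

proposition3 : (p : ℕ) → .{{_ : NonZero p}} → Prime p → 5 ≤ p →
    let open Arith p in
    (x y : Zp p) → IsGenerator x → x *ₚ y ≡ oneₚ →
    (πinv σinv : 𝓘 → 𝓘) →
    (∀ z → πinv (πmap x y z) ≡ z) → (∀ z → πmap x y (πinv z) ≡ z) →
    (∀ z → σinv (σmap y z) ≡ z) → (∀ z → σmap y (σinv z) ≡ z) →
    (a b : Zp p) → (z : 𝓘) →
    πinv (πab x (x *ₚ a , x *ₚ b) z) ≡ σinv (πinv (πab x (a , b) (σmap y z)))
proposition3 p _ _ x y _ xy πinv σinv πinv∘π πinv∘π⁻¹ σinv∘σ _ a b z = begin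
  πinv (πab x (x *ₚ a , x *ₚ b) z)
    ≡⟨ cong (πinv ∘ πab x (x *ₚ a , x *ₚ b)) (σx∘σy≗id z) ⟨
  πinv (πab x (x *ₚ a , x *ₚ b) (σmap x (σmap y z)))
    ≡⟨ cong πinv (UnitScaling.πab-σmap p x y yx≡1 x a b (σmap y z)) ⟩
  πinv (σmap x V)
    ≡⟨ inverse-commute (πmap x y) πinv (σmap x) πinv∘π πinv∘π⁻¹ (πmap-σmap x y x) V ⟩
  σmap x (πinv V)
    ≡⟨ left-inverse≗right-inverse (σmap y) (σmap x) σinv σinv∘σ σy∘σx≗id (πinv V) ⟨
  σinv (πinv V)
    ∎
  where
  open Arith p
  open ZpProperties p

  V : 𝓘
  V = πab x (a , b) (σmap y z)

  yx≡1 : y *ₚ x ≡ oneₚ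
  yx≡1 = trans (*ₚ-comm y x) xy

  σx∘σy≗id : ∀ w → σmap x (σmap y w) ≡ w
  σx∘σy≗id = UnitScaling.σ⁻¹∘σ≗id p y x xy

  σy∘σx≗id : ∀ w → σmap y (σmap x w) ≡ w
  σy∘σx≗id = UnitScaling.σ⁻¹∘σ≗id p x y yx≡1
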